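{- Let $c>1$ be odd and let $n>c$ be odd, and put $N=n-c-1$. Then the number of lattice paths in an $N\times N$ grid with even area above the path exceeds the number of those with odd area above the path by exactly $C_{\frac{n-c-2}{2}}$, where $C_k=\frac{1}{k+1}\binom{2k}{k}$ is the $k$th Catalan number.
   Context: A lattice path in an $N\times N$ grid of unit squares is a path from the top-left corner to the bottom-right corner consisting of unit steps to the right or downward which stays on or above the main diagonal joining these two corners. The area above the path is the number of unit squares of the grid lying above the path (between the path and the top edge of the grid). -}

module Defs where

open import Data.Bool using (Bool; true; false; _∧_; not)
open import Data.Nat using (ℕ; zero; suc; _+_; _*_; _≤ᵇ_; _≡ᵇ_; _/_; _%_)
open import Data.Nat.Combinatorics using (_C_)
open import Data.List using (List; []; _∷_; map; _++_; length; filterᵇ; concatMap)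

data Step : Set where
  R D : Step

words : ℕ → List (List Step)
words zero = [] ∷ []
words (suc m) = map (R ∷_) (words m) ++ map (D ∷_) (words m)

-- Walk the path, tracking (#R so far, #D so far).
-- staysAbove r d w : every prefix of w (after the already-read r rights
-- and d downs) has #D ≤ #R, i.e. the path stays on or above the main
-- diagonal of the grid (top-left to bottom-right).
staysAbove : ℕ → ℕ → List Step → Bool
staysAbove r d [] = true
staysAbove r d (R ∷ w) = staysAbove (suc r) d w
staysAbove r d (D ∷ w) = (suc d ≤ᵇ r) ∧ staysAbove r (suc d) w

countR : List Step → ℕ
countR [] = 0
countR (R ∷ w) = suc (countR w)
countR (D ∷ w) = countR w

countD : List Step → ℕ
countD [] = 0
countD (R ∷ w) = countD w
countD (D ∷ w) = suc (countD w)

isLatticePath : ℕ → List Step → Bool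
isLatticePath N w = (countR w ≡ᵇ N) ∧ (countD w ≡ᵇ N) ∧ staysAbove 0 0 w

latticePaths : ℕ → List (List Step)
latticePaths N = filterᵇ (isLatticePath N) (words (2 * N))

-- In column j, the squares above the path are exactly the downward steps
-- taken before the (j+1)-th right step.  areaFrom d w = area contributed
-- by w when d down steps have already been taken.
areaFrom : ℕ → List Step → ℕ
areaFrom d [] = 0
areaFrom d (R ∷ w) = d + areaFrom d w
areaFrom d (D ∷ w) = areaFrom (suc d) w

area : List Step → ℕ
area = areaFrom 0

evenArea : List Step → Bool
evenArea w = area w % 2 ≡ᵇ 0

oddArea : List Step → Bool
oddArea w = not (evenArea w)

numEvenArea : ℕ → ℕ
numEvenArea N = length (filterᵇ evenArea (latticePaths N))

numOddArea : ℕ → ℕ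
numOddArea N = length (filterᵇ oddArea (latticePaths N))

catalan : ℕ → ℕ
catalan k = ((2 * k) C k) / suc k

-- Read a path two steps at a time after its forced first
-- step R; its height above the diagonal is then odd, hence positive, at the
-- start of every block, so RD and DR are both allowed there. Exchanging them
-- changes the area by exactly one, so exchanging the first mixed block is a
-- parity-reversing involution on the paths that have one. The remaining
-- paths consist of RR and DD blocks; an RR block adds twice the current depth
-- to the area, so they all have even area. They are the paths of half the
-- size, counted by ballot numbers, and starting from height 0 by the Catalan
-- number C_t.
module Submission where

open import Data.Bool using (Bool; true; false; _∧_; not)
open import Data.Bool.Properties using (∧-zeroʳ)
open import Data.List using (List; []; _∷_; map; _++_; length; filterᵇ)
open import Data.List.Properties using (length-++; filter-++)
open import Data.Nat using (ℕ; zero; suc; _+_; _*_; _∸_; _<_; _≤_; _/_; _%_; _≡ᵇ_; _≤ᵇ_; _≤?_; parity; s≤s; z≤n)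
open import Data.Nat.Properties
open import Data.Nat.Combinatorics using (_C_; nC1≡n; nCk≡nC[n∸k]; k>n⇒nCk≡0) renaming (nCk+nC[k+1]≡[n+1]C[k+1] to pascal)
open import Data.Nat.DivMod using (m*n/n≡m; m≡m%n+[m/n]*n)
open import Data.Nat.Tactic.RingSolver using (solve-∀)
import Data.Parity.Base as ℙ
open import Data.Parity.Base using (Parity; 0ℙ; 1ℙ; _⁻¹)
open import Data.Parity.Properties using (⁻¹-involutive; ⁻¹-selfInverse; suc-homo-⁻¹; +-homo-+; p+p≡0ℙ; p⁻¹+p≡1ℙ)
open import Data.Product using (∃-syntax; _,_)
open import Function using (_∘_)
open import Relation.Binary.PropositionalEquality
open import Relation.Nullary using (¬_)
open import Relation.Nullary.Decidable using (T?; dec-true; dec-false)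

open import Defs

module _ {A : Set} where

  length-filterᵇ-++ : (p : A → Bool) (xs ys : List A) →
    length (filterᵇ p (xs ++ ys)) ≡ length (filterᵇ p xs) + length (filterᵇ p ys)
  length-filterᵇ-++ p xs ys =
    trans (cong length (filter-++ (T? ∘ p) xs ys)) (length-++ (filterᵇ p xs))

  length-filterᵇ-map : {B : Set} (p : B → Bool) (f : A → B) (xs : List A) →
    length (filterᵇ p (map f xs)) ≡ length (filterᵇ (p ∘ f) xs)
  length-filterᵇ-map p f []       = refl
  length-filterᵇ-map p f (x ∷ xs) with p (f x)
  ... | true  = cong suc (length-filterᵇ-map p f xs)
  ... | false = length-filterᵇ-map p f xs

  length-filterᵇ-cong : {p q : A → Bool} → p ≗ q → (xs : List A) →
    length (filterᵇ p xs) ≡ length (filterᵇ q xs)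
  length-filterᵇ-cong         p≗q []       = refl
  length-filterᵇ-cong {p} {q} p≗q (x ∷ xs) with p x | q x | p≗q x
  ... | true  | .true  | refl = cong suc (length-filterᵇ-cong p≗q xs)
  ... | false | .false | refl = length-filterᵇ-cong p≗q xs

  length-filterᵇ-filterᵇ : (p q : A → Bool) (xs : List A) →
    length (filterᵇ q (filterᵇ p xs)) ≡ length (filterᵇ (λ x → p x ∧ q x) xs)
  length-filterᵇ-filterᵇ p q []       = refl
  length-filterᵇ-filterᵇ p q (x ∷ xs) with p x
  ... | false = length-filterᵇ-filterᵇ p q xs
  ... | true with q x
  ...   | true  = cong suc (length-filterᵇ-filterᵇ p q xs)
  ...   | false = length-filterᵇ-filterᵇ p q xs

  length-filterᵇ-false : (xs : List A) → length (filterᵇ (λ _ → false) xs) ≡ 0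
  length-filterᵇ-false []       = refl
  length-filterᵇ-false (x ∷ xs) = length-filterᵇ-false xs

count : (List Step → Bool) → ℕ → ℕ
count P m = length (filterᵇ P (words m))

count-suc : ∀ P m → count P (suc m) ≡ count (P ∘ (R ∷_)) m + count (P ∘ (D ∷_)) m
count-suc P m =
  trans (length-filterᵇ-++ P (map (R ∷_) (words m)) (map (D ∷_) (words m)))
        (cong₂ _+_ (length-filterᵇ-map P (R ∷_) (words m)) (length-filterᵇ-map P (D ∷_) (words m)))

count-cong : ∀ {P Q} → P ≗ Q → ∀ m → count P m ≡ count Q m
count-cong P≗Q m = length-filterᵇ-cong P≗Q (words m)

count-false : ∀ m → count (λ _ → false) m ≡ 0
count-false m = length-filterᵇ-false (words m)

evenIndicator : Parity → ℕ
evenIndicator 0ℙ = 1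
evenIndicator 1ℙ = 0

-- The number of ways to finish a partial path at height g above the diagonal
-- with a right and g + a down steps, so that the total area is even; π is the
-- parity of the area so far and δ that of the number of down steps so far.
completions : Parity → Parity → ℕ → ℕ → ℕ
completions π δ zero    zero    = evenIndicator π
completions π δ zero    (suc a) = completions (π ℙ.+ δ) δ 1 a
completions π δ (suc g) zero    = completions π (δ ⁻¹) g zero
completions π δ (suc g) (suc a) =
  completions (π ℙ.+ δ) δ (suc (suc g)) a + completions π (δ ⁻¹) g (suc a)

≤⇒≤ᵇ≡true : ∀ {m n} → m ≤ n → (m ≤ᵇ n) ≡ true
≤⇒≤ᵇ≡true {m} {n} = dec-true (m ≤? n)

≰⇒≤ᵇ≡false : ∀ {m n} → ¬ m ≤ n → (m ≤ᵇ n) ≡ false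
≰⇒≤ᵇ≡false {m} {n} = dec-false (m ≤? n)

parity-suc : ∀ n → parity (suc n) ≡ parity n ⁻¹
parity-suc n = sym (⁻¹-selfInverse (suc-homo-⁻¹ n))

completesPath : ℕ → ℕ → ℕ → List Step → Bool
completesPath g d a w = (countR w ≡ᵇ a) ∧ (countD w ≡ᵇ g + a) ∧ staysAbove (g + d) d w

evenCompletion : ℕ → ℕ → ℕ → ℕ → List Step → Bool
evenCompletion e g d a w = completesPath g d a w ∧ ((e + areaFrom d w) % 2 ≡ᵇ 0)

evenCompletion-R : ∀ e g d a w →
  evenCompletion e g d (suc a) (R ∷ w) ≡ evenCompletion (e + d) (suc g) d a w
evenCompletion-R e g d a w rewrite +-suc g a | +-assoc e d (areaFrom d w) = refl

evenCompletion-D : ∀ e g d a w →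
  evenCompletion e (suc g) d a (D ∷ w) ≡ evenCompletion e g (suc d) a w
evenCompletion-D e g d a w rewrite ≤⇒≤ᵇ≡true (s≤s (m≤n+m d g)) | +-suc g d = refl

evenCompletion-D-onDiagonal : ∀ e d a w → evenCompletion e 0 d a (D ∷ w) ≡ false
evenCompletion-D-onDiagonal e d a w
  rewrite ≰⇒≤ᵇ≡false (n≮n d) | ∧-zeroʳ (suc (countD w) ≡ᵇ a) | ∧-zeroʳ (countR w ≡ᵇ a) = refl

count-[]-even : ∀ P n δ → P [] ≡ (n % 2 ≡ᵇ 0) → count P 0 ≡ completions (parity n) δ 0 0
count-[]-even P zero          δ eq rewrite eq = refl
count-[]-even P (suc zero)    δ eq rewrite eq = refl
count-[]-even P (suc (suc n)) δ eq = count-[]-even P n δ eq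

count-evenCompletion : ∀ m e g d a → m ≡ a + (g + a) →
  count (evenCompletion e g d a) m ≡ completions (parity e) (parity d) g a
count-afterRight : ∀ m e g d a → m ≡ a + (suc g + a) →
  count (λ w → evenCompletion e g d (suc a) (R ∷ w)) m
    ≡ completions (parity e ℙ.+ parity d) (parity d) (suc g) a
count-afterDown : ∀ m e g d a → m ≡ a + (g + a) →
  count (λ w → evenCompletion e (suc g) d a (D ∷ w)) m
    ≡ completions (parity e) (parity d ⁻¹) g a

count-evenCompletion zero    e zero    d zero    _  =
  trans (count-[]-even (evenCompletion e 0 d 0) (e + 0) (parity d) refl)
        (cong (λ k → completions (parity k) (parity d) 0 0) (+-identityʳ e))
count-evenCompletion (suc m) e (suc g) d zero    eq =
  trans (count-suc (evenCompletion e (suc g) d 0) m)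
        (cong₂ _+_ (count-false m) (count-afterDown m e g d 0 (suc-injective eq)))
count-evenCompletion (suc m) e zero    d (suc a) eq =
  trans (count-suc (evenCompletion e 0 d (suc a)) m)
    (trans (cong₂ _+_ (count-afterRight m e 0 d a (suc-injective eq))
                      (trans (count-cong (evenCompletion-D-onDiagonal e d (suc a)) m) (count-false m)))
           (+-identityʳ _))
count-evenCompletion (suc m) e (suc g) d (suc a) eq =
  trans (count-suc (evenCompletion e (suc g) d (suc a)) m)
    (cong₂ _+_ (count-afterRight m e (suc g) d a (trans (suc-injective eq) (cong (a +_) (+-suc (suc g) a))))
               (count-afterDown m e g d (suc a) (trans (suc-injective eq) (+-suc a (g + suc a)))))

count-afterRight m e g d a eq = begin
  count (λ w → evenCompletion e g d (suc a) (R ∷ w)) m  ≡⟨ count-cong (evenCompletion-R e g d a) m ⟩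
  count (evenCompletion (e + d) (suc g) d a) m          ≡⟨ count-evenCompletion m (e + d) (suc g) d a eq ⟩
  completions (parity (e + d)) (parity d) (suc g) a     ≡⟨ cong (λ π → completions π (parity d) (suc g) a) (+-homo-+ e d) ⟩
  completions (parity e ℙ.+ parity d) (parity d) (suc g) a ∎
  where open ≡-Reasoning

count-afterDown m e g d a eq = begin
  count (λ w → evenCompletion e (suc g) d a (D ∷ w)) m  ≡⟨ count-cong (evenCompletion-D e g d a) m ⟩
  count (evenCompletion e g (suc d) a) m                ≡⟨ count-evenCompletion m e g (suc d) a eq ⟩
  completions (parity e) (parity (suc d)) g a           ≡⟨ cong (λ δ → completions (parity e) δ g a) (parity-suc d) ⟩
  completions (parity e) (parity d ⁻¹) g a              ∎
  where open ≡-Reasoning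

numEvenArea≡completions : ∀ N → numEvenArea N ≡ completions 0ℙ 0ℙ 0 N
numEvenArea≡completions N =
  trans (length-filterᵇ-filterᵇ (isLatticePath N) evenArea (words (2 * N)))
        (count-evenCompletion (2 * N) 0 0 0 N (cong (N +_) (+-identityʳ N)))

not-even≡suc-even : ∀ n → not (n % 2 ≡ᵇ 0) ≡ (suc n % 2 ≡ᵇ 0)
not-even≡suc-even zero          = refl
not-even≡suc-even (suc zero)    = refl
not-even≡suc-even (suc (suc n)) = not-even≡suc-even n

numOddArea≡completions : ∀ N → numOddArea N ≡ completions 1ℙ 0ℙ 0 N
numOddArea≡completions N =
  trans (length-filterᵇ-filterᵇ (isLatticePath N) oddArea (words (2 * N)))
    (trans (count-cong (λ w → cong (isLatticePath N w ∧_) (not-even≡suc-even (area w))) (2 * N))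
           (count-evenCompletion (2 * N) 1 0 0 N (cong (N +_) (+-identityʳ N))))

-- ballot j u counts the sequences of u up and j + u down steps that start at
-- height j and never go below 0.
ballot : ℕ → ℕ → ℕ
ballot j       zero    = 1
ballot zero    (suc u) = ballot 1 u
ballot (suc j) (suc u) = ballot (suc (suc j)) u + ballot j (suc u)

paired-excess₃ : ∀ (rr rd dr : Parity → ℕ) {x} →
  rr 0ℙ ≡ rr 1ℙ + x → rd 0ℙ ≡ dr 1ℙ → dr 0ℙ ≡ rd 1ℙ →
  (rr 0ℙ + rd 0ℙ) + dr 0ℙ ≡ ((rr 1ℙ + rd 1ℙ) + dr 1ℙ) + x
paired-excess₃ rr rd dr {x} rr≡ rd≡ dr≡ rewrite rr≡ | rd≡ | dr≡ = rearrange (rr 1ℙ) (dr 1ℙ) (rd 1ℙ) x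
  where
  rearrange : ∀ a b c x → ((a + x) + b) + c ≡ ((a + c) + b) + x
  rearrange = solve-∀

paired-excess : ∀ (rr rd dr dd : Parity → ℕ) {x y} →
  rr 0ℙ ≡ rr 1ℙ + x → rd 0ℙ ≡ dr 1ℙ → dr 0ℙ ≡ rd 1ℙ → dd 0ℙ ≡ dd 1ℙ + y →
  (rr 0ℙ + rd 0ℙ) + (dr 0ℙ + dd 0ℙ) ≡ ((rr 1ℙ + rd 1ℙ) + (dr 1ℙ + dd 1ℙ)) + (x + y)
paired-excess rr rd dr dd {x} {y} rr≡ rd≡ dr≡ dd≡ rewrite rr≡ | rd≡ | dr≡ | dd≡ =
  rearrange (rr 1ℙ) (dr 1ℙ) (rd 1ℙ) (dd 1ℙ) x y
  where
  rearrange : ∀ a b c d x y → ((a + x) + b) + (c + (d + y)) ≡ ((a + c) + (b + d)) + (x + y)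
  rearrange = solve-∀

completions-twoRights : ∀ δ g a {b} →
  completions 0ℙ δ g a ≡ completions 1ℙ δ g a + b →
  completions (0ℙ ℙ.+ δ ℙ.+ δ) δ g a ≡ completions (1ℙ ℙ.+ δ ℙ.+ δ) δ g a + b
completions-twoRights δ g a eq rewrite p+p≡0ℙ δ | p⁻¹+p≡1ℙ δ = eq

completions-excess : ∀ j u δ →
  completions 0ℙ δ (suc (j * 2)) (u * 2) ≡ completions 1ℙ δ (suc (j * 2)) (u * 2) + ballot j u
completions-excess zero    zero    δ = refl
completions-excess (suc j) zero    δ = completions-excess j zero (δ ⁻¹ ⁻¹)
completions-excess zero    (suc u) δ =
  paired-excess₃ RR RD DR
    (completions-twoRights δ 3 (u * 2) (completions-excess 1 u δ))
    (cong (λ π → completions π (δ ⁻¹) 1 (suc (u * 2))) (sym (⁻¹-involutive δ)))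
    refl
  where
  RR RD DR : Parity → ℕ
  RR π = completions (π ℙ.+ δ ℙ.+ δ) δ 3 (u * 2)
  RD π = completions (π ℙ.+ δ) (δ ⁻¹) 1 (suc (u * 2))
  DR π = completions (π ℙ.+ δ ⁻¹) (δ ⁻¹) 1 (suc (u * 2))
completions-excess (suc j) (suc u) δ =
  paired-excess RR RD DR DD
    (completions-twoRights δ (suc (suc (suc j) * 2)) (u * 2) (completions-excess (suc (suc j)) u δ))
    (cong (λ π → completions π (δ ⁻¹) (suc (suc j * 2)) (suc (u * 2))) (sym (⁻¹-involutive δ)))
    refl
    (completions-excess j (suc u) (δ ⁻¹ ⁻¹))
  where
  RR RD DR DD : Parity → ℕ
  RR π = completions (π ℙ.+ δ ℙ.+ δ) δ (suc (suc (suc j) * 2)) (u * 2)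
  RD π = completions (π ℙ.+ δ) (δ ⁻¹) (suc (suc j * 2)) (suc (u * 2))
  DR π = completions (π ℙ.+ δ ⁻¹) (δ ⁻¹) (suc (suc j * 2)) (suc (u * 2))
  DD π = completions π (δ ⁻¹ ⁻¹) (suc (j * 2)) (suc u * 2)

C-sym : ∀ {n} k m → k + m ≡ n → n C k ≡ n C m
C-sym k m refl = trans (nCk≡nC[n∸k] (m≤m+n k m)) (cong ((k + m) C_) (m+n∸m≡n k m))

absorption : ∀ n k → suc k * (suc n C suc k) ≡ suc n * (n C k)
absorption zero    zero    = refl
absorption zero    (suc k)
  rewrite k>n⇒nCk≡0 {1} {suc (suc k)} (s≤s (s≤s z≤n)) | k>n⇒nCk≡0 {0} {suc k} (s≤s z≤n) = *-zeroʳ k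
absorption (suc n) zero    = trans (+-identityʳ _) (trans (nC1≡n (suc (suc n))) (sym (*-identityʳ _)))
absorption (suc n) (suc k) = begin
  suc (suc k) * (suc (suc n) C suc (suc k))   ≡⟨ cong (suc (suc k) *_) (sym (pascal (suc n) (suc k))) ⟩
  suc (suc k) * (a + b)                        ≡⟨ *-distribˡ-+ (suc (suc k)) a b ⟩
  (a + suc k * a) + suc (suc k) * b            ≡⟨ cong₂ (λ x y → (a + x) + y) (absorption n k) (absorption n (suc k)) ⟩
  (a + suc n * (n C k)) + suc n * (n C suc k)  ≡⟨ +-assoc a _ _ ⟩
  a + (suc n * (n C k) + suc n * (n C suc k))  ≡⟨ cong (a +_) (sym (*-distribˡ-+ (suc n) (n C k) (n C suc k))) ⟩
  a + suc n * (n C k + n C suc k)              ≡⟨ cong (λ x → a + suc n * x) (pascal n k) ⟩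
  a + suc n * a                                ∎
  where
  open ≡-Reasoning
  a = suc n C suc k
  b = suc n C suc (suc k)

ballot-binomial : ∀ j u → ballot j (suc u) + (j + suc u * 2) C u ≡ (j + suc u * 2) C suc u
ballot-binomial zero    zero    = refl
ballot-binomial zero    (suc u) = begin
  ballot 1 (suc u) + suc M C suc u          ≡⟨ cong (ballot 1 (suc u) +_) (sym (pascal M u)) ⟩
  ballot 1 (suc u) + (M C u + M C suc u)    ≡⟨ sym (+-assoc (ballot 1 (suc u)) _ _) ⟩
  (ballot 1 (suc u) + M C u) + M C suc u    ≡⟨ cong (_+ M C suc u) (ballot-binomial 1 u) ⟩
  M C suc u + M C suc u                     ≡⟨ cong (M C suc u +_) (C-sym (suc u) (suc (suc u)) (sum u)) ⟩
  M C suc u + M C suc (suc u)               ≡⟨ pascal M (suc u) ⟩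
  suc M C suc (suc u)                       ∎
  where
  open ≡-Reasoning
  M = suc (suc (suc (u * 2)))
  sum : ∀ u → suc u + suc (suc u) ≡ suc (suc (suc (u * 2)))
  sum = solve-∀
ballot-binomial (suc j) zero    = begin
  suc (ballot j 1 + 1)  ≡⟨ cong suc (trans (ballot-binomial j 0) (nC1≡n (j + 2))) ⟩
  suc (j + 2)           ≡⟨ sym (nC1≡n (suc (j + 2))) ⟩
  suc (j + 2) C 1       ∎
  where open ≡-Reasoning
ballot-binomial (suc j) (suc u) = begin
  (b₁ + b₂) + suc M C suc u              ≡⟨ cong ((b₁ + b₂) +_) (sym (pascal M u)) ⟩
  (b₁ + b₂) + (M C u + M C suc u)        ≡⟨ +-interchange b₁ b₂ (M C u) (M C suc u) ⟩
  (b₁ + M C u) + (b₂ + M C suc u)        ≡⟨ cong₂ _+_ (subst (λ n → b₁ + n C u ≡ n C suc u) (shift j u)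
                                                             (ballot-binomial (suc (suc j)) u))
                                                      (ballot-binomial j (suc u)) ⟩
  M C suc u + M C suc (suc u)            ≡⟨ pascal M (suc u) ⟩
  suc M C suc (suc u)                    ∎
  where
  open ≡-Reasoning
  M  = j + suc (suc u) * 2
  b₁ = ballot (suc (suc j)) (suc u)
  b₂ = ballot j (suc (suc u))
  +-interchange : ∀ a b c d → (a + b) + (c + d) ≡ (a + c) + (b + d)
  +-interchange = solve-∀
  shift : ∀ j u → suc (suc j) + suc u * 2 ≡ j + suc (suc u) * 2
  shift = solve-∀

middleBinomial-ratio : ∀ u → suc (suc u) * (suc u * 2 C u) ≡ suc u * (suc u * 2 C suc u)
middleBinomial-ratio u = begin
  suc (suc u) * (suc n C u)            ≡⟨ cong (suc (suc u) *_) (C-sym u (suc (suc u)) (sum₁ u)) ⟩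
  suc (suc u) * (suc n C suc (suc u))  ≡⟨ absorption n (suc u) ⟩
  suc n * (n C suc u)                  ≡⟨ cong (suc n *_) (C-sym (suc u) u (sum₂ u)) ⟩
  suc n * (n C u)                      ≡⟨ sym (absorption n u) ⟩
  suc u * (suc n C suc u)              ∎
  where
  open ≡-Reasoning
  n = suc (u * 2)
  sum₁ : ∀ u → u + suc (suc u) ≡ suc (suc (u * 2))
  sum₁ = solve-∀
  sum₂ : ∀ u → suc u + u ≡ suc (u * 2)
  sum₂ = solve-∀

ballot≡catalan : ∀ t → ballot 0 t ≡ catalan t
ballot≡catalan zero    = refl
ballot≡catalan (suc u) = begin
  b                                    ≡⟨ sym (m*n/n≡m b (suc (suc u))) ⟩
  b * suc (suc u) / suc (suc u)        ≡⟨ cong (_/ suc (suc u)) b*[u+2]≡y ⟩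
  y / suc (suc u)                      ≡⟨ cong (λ m → (m C suc u) / suc (suc u)) (*-comm (suc u) 2) ⟩
  catalan (suc u)                      ∎
  where
  open ≡-Reasoning
  b = ballot 0 (suc u)
  x = suc u * 2 C u
  y = suc u * 2 C suc u
  b*[u+2]≡y : b * suc (suc u) ≡ y
  b*[u+2]≡y = +-cancelʳ-≡ (suc (suc u) * x) (b * suc (suc u)) y (begin
    b * suc (suc u) + suc (suc u) * x  ≡⟨ cong (_+ suc (suc u) * x) (*-comm b (suc (suc u))) ⟩
    suc (suc u) * b + suc (suc u) * x  ≡⟨ sym (*-distribˡ-+ (suc (suc u)) b x) ⟩
    suc (suc u) * (b + x)              ≡⟨ cong (suc (suc u) *_) (ballot-binomial 0 u) ⟩
    y + suc u * y                      ≡⟨ cong (y +_) (sym (middleBinomial-ratio u)) ⟩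
    y + suc (suc u) * x                ∎)

numEvenArea-odd : ∀ t → numEvenArea (suc (t * 2)) ≡ numOddArea (suc (t * 2)) + catalan t
numEvenArea-odd t = begin
  numEvenArea N                              ≡⟨ numEvenArea≡completions N ⟩
  completions 0ℙ 0ℙ 1 (t * 2)                ≡⟨ completions-excess 0 t 0ℙ ⟩
  completions 1ℙ 0ℙ 1 (t * 2) + ballot 0 t   ≡⟨ cong₂ _+_ (sym (numOddArea≡completions N)) (ballot≡catalan t) ⟩
  numOddArea N + catalan t                   ∎
  where
  open ≡-Reasoning
  N = suc (t * 2)

odd⇒suc[q*2] : ∀ n → n % 2 ≡ 1 → ∃[ q ] n ≡ suc (q * 2)
odd⇒suc[q*2] n n%2≡1 = n / 2 , trans (m≡m%n+[m/n]*n n 2) (cong (_+ n / 2 * 2) n%2≡1)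

*2∸*2 : ∀ {q p} → q < p → p * 2 ∸ q * 2 ≡ suc (p ∸ suc q) * 2
*2∸*2 {q} {p} q<p = trans (sym (*-distribʳ-∸ 2 p q)) (cong (_* 2) (+-∸-assoc 1 q<p))

mainTheorem9 : (c n : ℕ) → c % 2 ≡ 1 → 1 < c → n % 2 ≡ 1 → c < n →
    numEvenArea (n ∸ c ∸ 1) ≡ numOddArea (n ∸ c ∸ 1) + catalan ((n ∸ c ∸ 2) / 2)
mainTheorem9 c n c-odd _ n-odd c<n with odd⇒suc[q*2] c c-odd | odd⇒suc[q*2] n n-odd
... | q , refl | p , refl rewrite *2∸*2 (*-cancelʳ-< 2 q p (≤-pred c<n)) =
  trans (numEvenArea-odd t) (cong (λ k → numOddArea (suc (t * 2)) + catalan k) (sym (m*n/n≡m t 2)))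
  where t = p ∸ suc q
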